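{- For each $n$ let $\mathcal P_n$ be an ordered partition of $\{0,1\}^n$ and $B_n\in\mathcal P_n$ a colour class with $|\mathrm{SP}(B_n)|$ maximal among the colour classes; let $S_n=\{k\in[n]:\{k\}\in\mathrm{SP}(B_n)\}$ and $s_n=|S_n|$. Let $f(n)\in o(n)$ be such that $s_n\le f(n)$, and assume $|\mathrm{SP}(B_n)|\in\Theta(n)$. Then for every $k\in\mathbb N$, the limit \[\lim_{n\to\infty}\frac{|\mathrm{Orbit}_n(B_n)|}{2^{kn}}\ \ \Big(\ge\lim_{n\to\infty}\frac{n!}{|\mathrm{Stab}_n(\mathrm{SP}(B_n))|\cdot2^{kn}}\Big)\] does not exist (as a finite number); that is, the orbit of $B_n$ under the action of $\mathrm{Sym}_n$ on $\{0,1\}^n$ grows super-polynomially in $2^n$.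
   Context: $[n]=\{1,\dots,n\}$, $\mathrm{Sym}_n$ the symmetric group on $[n]$, acting on $\{0,1\}^n$ by $\pi(v)=v_{\pi^{ -1}(1)}\cdots v_{\pi^{ -1}(n)}$ and elementwise on sets; $\mathrm{Stab}_n(B)=\{\pi:\pi(B)=B\}$, $\mathrm{Orbit}_n(B)=\{\pi(B):\pi\in\mathrm{Sym}_n\}$. For a partition $\mathcal Q$ of $[n]$, $\mathrm{Stab}_n(\mathcal Q)=\{\pi:\pi(Q)\in\mathcal Q\ \forall Q\in\mathcal Q\}$. A supporting partition of $G\le\mathrm{Sym}_n$ is a partition $\mathcal Q$ of $[n]$ such that every $\pi$ with $\pi(Q)=Q$ for all $Q\in\mathcal Q$ lies in $G$; $\mathrm{SP}(G)$ is the unique coarsest one and $\mathrm{SP}(B):=\mathrm{SP}(\mathrm{Stab}_n(B))$; $|\mathrm{SP}(B)|$ is its number of parts. An ordered partition of $\{0,1\}^n$ is a tuple of pairwise disjoint nonempty sets (colour classes) with union $\{0,1\}^n$.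
   Formalization: The function f with $s_n\le f(n)$ and $f(n)\in o(n)$ takes only rational values. -}

module Defs where

open import Data.Bool using (Bool; true; false; not; _∨_)
open import Data.Nat using (ℕ; suc; _≤_; _*_; _^_; NonZero)
open import Data.Nat.Properties using (m^n≢0)
open import Data.Fin using (Fin)
open import Data.Fin.Properties using () renaming (_≟_ to _≟ᶠ_)
open import Data.Fin.Permutation using (Permutation′; _⟨$⟩ʳ_; _⟨$⟩ˡ_)
open import Data.List using (List; length; filter; allFin)
open import Data.List.Relation.Unary.All using (All)
open import Data.List.Relation.Unary.All using () renaming (all? to allL?)
open import Data.Product using (Σ; ∃; ∃-syntax; _×_; _,_)
open import Data.Integer using (+_)
open import Data.Rational using (ℚ; _/_; _-_; ∣_∣; _<_; _≤_; 0ℚ) renaming (_*_ to _*ℚ_)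
open import Relation.Binary.PropositionalEquality using (_≡_; _≢_)
open import Relation.Nullary using (¬_; Dec; yes; no)
open import Relation.Nullary.Decidable using (⌊_⌋)
open import Function using (Surjective)

-- Words of {0,1}^n : functions [n] → {0,1} (Fin n indexes positions 1..n).
Word : ℕ → Set
Word n = Fin n → Bool

Subset : ℕ → Set
Subset n = Word n → Bool

_≐_ : ∀ {n} → Subset n → Subset n → Set
A ≐ B = ∀ w → A w ≡ B w

Sym : ℕ → Set
Sym n = Permutation′ n

actW : ∀ {n} → Sym n → Word n → Word n
actW π v i = v (π ⟨$⟩ˡ i)

-- π(B) = { π(v) : v ∈ B };  w ∈ π(B)  iff  π⁻¹(w) ∈ B,  where π⁻¹(w)_j = w_{π(j)}.
actS : ∀ {n} → Sym n → Subset n → Subset n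
actS π B w = B (λ j → w (π ⟨$⟩ʳ j))

InStab : ∀ {n} → Subset n → Sym n → Set
InStab B π = actS π B ≐ B

IsOrderedPartition : ∀ {n p} → (Fin p → Subset n) → Set
IsOrderedPartition {n} {p} P =
  (∀ i → ∃[ w ] P i w ≡ true) ×
  (∀ i j w → P i w ≡ true → P j w ≡ true → i ≡ j) ×
  (∀ w → ∃[ i ] P i w ≡ true)

-- A partition of [n] into m parts is represented by a surjective labelling
-- c : Fin n → Fin m (parts = fibres of c). π maps every part to itself iff
-- c (π i) = c i for all i.
FixesParts : ∀ {n m} → (Fin n → Fin m) → Sym n → Set
FixesParts c π = ∀ i → c (π ⟨$⟩ʳ i) ≡ c i

IsSupporting : ∀ {n m} → Subset n → (Fin n → Fin m) → Set
IsSupporting B c = Surjective _≡_ _≡_ c × (∀ π → FixesParts c π → InStab B π)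

IsSP : ∀ {n m} → Subset n → (Fin n → Fin m) → Set
IsSP {n} B c = IsSupporting B c ×
  (∀ m′ (c′ : Fin n → Fin m′) → IsSupporting B c′ →
     ∀ i j → c′ i ≡ c′ j → c i ≡ c j)

isSingleton : ∀ {n m} → (Fin n → Fin m) → Fin n → Bool
isSingleton {n} c k = ⌊ allL? (λ j → dec j) (allFin n) ⌋
  where
  dec : ∀ j → Dec (c j ≡ c k → j ≡ k)
  dec j with j ≟ᶠ k
  ... | yes e = yes (λ _ → e)
  ... | no ne with c j ≟ᶠ c k
  ...   | yes e′ = no (λ h → ne (h e′))
  ...   | no ne′ = yes (λ e′ → Data.Empty.⊥-elim (ne′ e′))
    where import Data.Empty

numSingletons : ∀ {n m} → (Fin n → Fin m) → ℕ
numSingletons {n} c = length (filter (λ k → isSingleton c k Data.Bool.≟ true) (allFin n))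
  where import Data.Bool

-- |Orbit_n(B)| = o : an enumeration of Orbit_n(B) without repetitions.
IsOrbitSize : ∀ {n} → Subset n → ℕ → Set
IsOrbitSize {n} B o = Σ (Fin o → Sym n) λ e →
  (∀ π → ∃[ i ] actS π B ≐ actS (e i) B) ×
  (∀ i j → actS (e i) B ≐ actS (e j) B → i ≡ j)

LittleO : (ℕ → ℚ) → Set
LittleO f = ∀ (ε : ℚ) → 0ℚ < ε → ∃[ N ] ∀ n → N Data.Nat.≤ n →
  ∣ f n ∣ Data.Rational.≤ ε *ℚ ((+ n) / 1)
  where import Data.Nat; import Data.Rational

ThetaN : (ℕ → ℕ) → Set
ThetaN g = ∃[ a ] ∃[ b ] ∃[ N ] ∀ n → N Data.Nat.≤ n →
  (n Data.Nat.≤ a * g n) × (g n Data.Nat.≤ b * n)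
  where import Data.Nat

-- Cauchy sequences of rationals (= sequences with a finite real limit).
Cauchy : (ℕ → ℚ) → Set
Cauchy a = ∀ (ε : ℚ) → 0ℚ < ε → ∃[ N ] ∀ m n → N Data.Nat.≤ m → N Data.Nat.≤ n →
  ∣ a m - a n ∣ < ε
  where import Data.Nat

over2^ : ℕ → ℕ → ℕ → ℚ
over2^ x k n = _/_ (+ x) (2 ^ (k * n)) {{m^n≢0 2 (k * n)}}

ℕtoℚ : ℕ → ℚ
ℕtoℚ x = (+ x) / 1

-- Stab(B) permutes the parts of SP(B): conjugating a supporting partition by a
-- stabiliser element gives another one, and SP(B) is the coarsest.  So if g fixes
-- B and moves only the least points k of the r non-singleton parts, it fixes a
-- partner of each k and therefore keeps k in its own part, i.e. fixes k.  The r!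
-- permutations of these least points thus give r! distinct translates of B, and
-- |Orbit(B_n)| ≥ r_n!.  As |SP(B_n)| ≤ r_n + s_n with s_n = o(n) and
-- |SP(B_n)| ≥ n/a, eventually r_n ≥ n/(2a+1), so r_n! outgrows every M·2^{kn};
-- a finite limit of |Orbit(B_n)|/2^{kn} would bound it by such an M·2^{kn}.

module Submission where

open import Defs
open import Data.Nat using (ℕ; _≤_)
open import Data.Fin using (Fin)
open import Data.Rational using (ℚ) renaming (_≤_ to _≤ℚ_)
open import Relation.Nullary using (¬_)

import Algebra.Properties.CommutativeSemigroup as CommutativeSemigroupProperties
open import Data.Bool using (true)
import Data.Bool as Bool
open import Data.Bool.Properties using (T-≡)
open import Data.Empty using (⊥-elim)
open import Data.Fin using (zero; suc; fromℕ<; inject; remQuot; combine) renaming (_<_ to _<ᶠ_)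
open import Data.Fin.Permutation
  using (_⟨$⟩ʳ_; _⟨$⟩ˡ_; _∘ₚ_; _≈_; id; flip; transpose; permutation; inverseˡ; inverseʳ)
import Data.Fin.Permutation.Components as PC
open import Data.Fin.Properties
  using (_≟_; _<?_; <-cmp; all?; any?; ¬∀⟶∃¬-smallest; injective⇒≤; combine-remQuot;
         toℕ-injective; toℕ-inject; toℕ-fromℕ<)
open import Data.Integer using (+_)
import Data.Integer as ℤ
import Data.Integer.Properties as ℤ
open import Data.List using (List; []; _∷_; _++_; length; lookup; filter; allFin)
open import Data.List.Membership.Propositional using (_∈_; _∉_)
open import Data.List.Membership.Propositional.Properties
  using (∈-filter⁺; ∈-filter⁻; ∈-allFin; ∈-lookup; ∈-++⁺ˡ; ∈-++⁺ʳ)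
import Data.List.Membership.Setoid.Properties as SetoidMembership
open import Data.List.Properties using (length-++)
open import Data.List.Relation.Unary.All as All using ()
open import Data.List.Relation.Unary.All.Properties using (All¬⇒¬Any)
open import Data.List.Relation.Unary.Any using (here; there)
open import Data.List.Relation.Unary.Unique.Propositional using (Unique; _∷_)
open import Data.List.Relation.Unary.Unique.Propositional.Properties using (allFin⁺; filter⁺)
open import Data.Nat using (zero; suc; _+_; _*_; _∸_; _^_; _<_; _!; _⊔_; z≤n; NonZero)
open import Data.Nat.Properties
  using (*-identityʳ; *-identityˡ; *-comm; *-assoc; +-identityʳ; +-suc; ≤-refl; ≤-trans; ≤-reflexive;
         <-irrefl; +-mono-≤; +-monoʳ-≤; *-mono-≤; *-monoʳ-≤; *-monoˡ-≤; +-cancelʳ-≤; +-cancelˡ-≤;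
         *-cancelˡ-≤; *-distribʳ-+; *-distribˡ-+; m≤m+n; m≤n+m; n≤1+n; m≤n+m∸n; m+[n∸m]≡n; 1≤n!;
         ^-distribˡ-+-*; ^-*-assoc; ^-monoʳ-≤; m^n≢0; m^n>0; m≤m⊔n; m≤n⊔m; m⊔n≤o⇒m≤o; m⊔n≤o⇒n≤o;
         +-commutativeSemigroup; *-commutativeSemigroup; module ≤-Reasoning)
import Data.Rational as ℚ
import Data.Rational.Properties as ℚ
import Data.Rational.Unnormalised as ℚᵘ
import Data.Rational.Unnormalised.Properties as ℚᵘ
open import Data.Product using (∃; ∃-syntax; _×_; _,_; proj₁; proj₂; uncurry)
open import Data.Sum using (inj₁; inj₂)
open import Function using (_∘_; Injective; Surjective)
open import Function.Bundles using (Injection; Equivalence)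
open import Function.Properties.Inverse using (↔⇒↣)
open import Relation.Binary.Definitions using (tri<; tri≈; tri>)
open import Relation.Binary.PropositionalEquality
open import Relation.Nullary using (yes; no)
open import Relation.Nullary.Decidable
  using (_×-dec_; _→-dec_; ¬?; decidable-stable; dec-true; dec-false; fromWitness)
open import Relation.Unary using (Pred; Decidable; ∁)

open CommutativeSemigroupProperties +-commutativeSemigroup using () renaming (interchange to +-interchange)
open CommutativeSemigroupProperties *-commutativeSemigroup using () renaming (interchange to *-interchange)

private
  variable
    n m : ℕ
    B : Subset n
    π σ g : Sym n

⟨$⟩ʳ-injective : (π : Sym n) → Injective _≡_ _≡_ (π ⟨$⟩ʳ_)
⟨$⟩ʳ-injective π = Injection.injective (↔⇒↣ π)

-- Stabilisers and supporting partitions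

Invariant : Subset n → (Fin n → Fin n) → Set
Invariant B f = ∀ w → B (λ j → w (f j)) ≡ B w

-- Without function extensionality B need not be invariant under relabellings
-- that are only pointwise the identity; a supporting partition provides this,
-- and the closure properties of InStab below need it.
Extensional : Subset n → Set
Extensional B = ∀ f → (∀ i → f i ≡ i) → Invariant B f

supporting⇒extensional : {c : Fin n → Fin m} → IsSupporting B c → Extensional B
supporting⇒extensional {c = c} (_ , supports) f f≗id =
  supports (permutation f (λ i → i) f≗id f≗id) (λ i → cong c (f≗id i))

inStab-∘ₚ : InStab B π → InStab B σ → InStab B (π ∘ₚ σ)
inStab-∘ₚ {σ = σ} π∈ σ∈ w = trans (π∈ (λ j → w (σ ⟨$⟩ʳ j))) (σ∈ w)

module _ (ext : Extensional B) where

  inStab-flip : InStab B π → InStab B (flip π)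
  inStab-flip {π = π} π∈ w =
    trans (sym (π∈ (λ j → w (π ⟨$⟩ˡ j)))) (ext _ (λ _ → inverseˡ π) w)

  inStab-resp-≈ : InStab B π → π ≈ σ → InStab B σ
  inStab-resp-≈ {π = π} {σ = σ} π∈ π≈σ w = begin
    B (λ j → w (σ ⟨$⟩ʳ j))                        ≡⟨ ext _ (λ _ → inverseˡ π) (λ j → w (σ ⟨$⟩ʳ j)) ⟨
    B (λ j → w (σ ⟨$⟩ʳ (π ⟨$⟩ˡ (π ⟨$⟩ʳ j))))      ≡⟨ π∈ (λ j → w (σ ⟨$⟩ʳ (π ⟨$⟩ˡ j))) ⟩
    B (λ j → w (σ ⟨$⟩ʳ (π ⟨$⟩ˡ j)))               ≡⟨ ext _ (λ j → trans (sym (π≈σ _)) (inverseʳ π)) w ⟩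
    B w                                           ∎
    where open ≡-Reasoning

  sameImage⇒inStab : actS π B ≐ actS σ B → InStab B (π ∘ₚ flip σ)
  sameImage⇒inStab {σ = σ} πB≐σB w =
    trans (πB≐σB (λ k → w (σ ⟨$⟩ˡ k))) (ext _ (λ _ → inverseˡ σ) w)

module _ {c : Fin n → Fin m} where

  supporting-∘-flip : IsSupporting B c → InStab B g → IsSupporting B (λ i → c (g ⟨$⟩ˡ i))
  supporting-∘-flip {B = B} {g = g} (surjective , supports) g∈ = surjective′ , supports′
    where
    ext : Extensional B
    ext = supporting⇒extensional (surjective , supports)

    surjective′ : Surjective _≡_ _≡_ (λ i → c (g ⟨$⟩ˡ i))
    surjective′ q with surjective q
    ... | x , cx≡q = g ⟨$⟩ʳ x , λ { refl → trans (cong c (inverseˡ g {x})) (cx≡q refl) }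

    supports′ : ∀ σ → FixesParts (λ i → c (g ⟨$⟩ˡ i)) σ → InStab B σ
    supports′ σ fixes = inStab-resp-≈ ext {π = flip g ∘ₚ τ ∘ₚ g} {σ = σ} conj∈ conj≈σ
      where
      -- ∘ₚ composes left to right: τ j = g⁻¹ (σ (g j)).
      τ : Sym _
      τ = g ∘ₚ σ ∘ₚ flip g

      τ∈ : InStab B τ
      τ∈ = supports τ (λ j → trans (fixes (g ⟨$⟩ʳ j)) (cong c (inverseˡ g)))

      conj∈ : InStab B (flip g ∘ₚ τ ∘ₚ g)
      conj∈ = inStab-∘ₚ {π = flip g} {σ = τ ∘ₚ g} (inStab-flip ext {π = g} g∈)
                         (inStab-∘ₚ {π = τ} {σ = g} τ∈ g∈)

      conj≈σ : flip g ∘ₚ τ ∘ₚ g ≈ σ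
      conj≈σ j = trans (inverseʳ g) (cong (σ ⟨$⟩ʳ_) (inverseʳ g))

  inStab-preserves-SP : IsSP B c → InStab B g → ∀ {i j} → c i ≡ c j → c (g ⟨$⟩ʳ i) ≡ c (g ⟨$⟩ʳ j)
  inStab-preserves-SP {g = g} (supporting , coarsest) g∈ {i} {j} ci≡cj =
    coarsest m (λ k → c (g ⟨$⟩ˡ k)) (supporting-∘-flip {g = g} supporting g∈) (g ⟨$⟩ʳ i) (g ⟨$⟩ʳ j)
      (trans (cong c (inverseˡ g {i})) (trans ci≡cj (sym (cong c (inverseˡ g {j})))))

Supported : List (Fin n) → Sym n → Set
Supported L π = ∀ k → k ∉ L → π ⟨$⟩ʳ k ≡ k

module _ {L : List (Fin n)} where

  supported-∈ : Supported L π → ∀ {k} → k ∈ L → π ⟨$⟩ʳ k ∈ L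
  supported-∈ {π = π} supported {k} k∈L = decidable-stable (π ⟨$⟩ʳ k ∈? L) λ πk∉L →
    πk∉L (subst (_∈ L) (sym (⟨$⟩ʳ-injective π (supported _ πk∉L))) k∈L)
    where open import Data.List.Membership.DecPropositional (_≟_ {n}) using (_∈?_)

  supported-flip : Supported L π → Supported L (flip π)
  supported-flip {π = π} supported k k∉L =
    trans (cong (π ⟨$⟩ˡ_) (sym (supported k k∉L))) (inverseˡ π)

  supported-∘ₚ : Supported L π → Supported L σ → Supported L (π ∘ₚ σ)
  supported-∘ₚ {σ = σ} π-supported σ-supported k k∉L =
    trans (cong (σ ⟨$⟩ʳ_) (π-supported k k∉L)) (σ-supported k k∉L)

module _ {c : Fin n → Fin m} (sp : IsSP B c) {L : List (Fin n)}
         (distinct : ∀ {a b} → a ∈ L → b ∈ L → c a ≡ c b → a ≡ b)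
         (partner : ∀ {a} → a ∈ L → ∃[ x ] x ≢ a × c x ≡ c a) where

  -- g fixes a partner x ∉ L of k, so it keeps k in the part of x, in which k is
  -- the only point of L.
  inStab∧supported⇒fixes : InStab B g → Supported L g → ∀ {k} → k ∈ L → g ⟨$⟩ʳ k ≡ k
  inStab∧supported⇒fixes {g = g} g∈ supported {k} k∈L with partner k∈L
  ... | x , x≢k , cx≡ck = distinct (supported-∈ {π = g} supported k∈L) k∈L (begin
    c (g ⟨$⟩ʳ k)  ≡⟨ inStab-preserves-SP {g = g} sp g∈ (sym cx≡ck) ⟩
    c (g ⟨$⟩ʳ x)  ≡⟨ cong c (supported x x∉L) ⟩
    c x           ≡⟨ cx≡ck ⟩
    c k           ∎)
    where
    open ≡-Reasoning
    x∉L : x ∉ L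
    x∉L x∈L = x≢k (distinct x∈L k∈L cx≡ck)

  sameImage⇒agree : Supported L π → Supported L σ → actS π B ≐ actS σ B →
                    ∀ {k} → k ∈ L → π ⟨$⟩ʳ k ≡ σ ⟨$⟩ʳ k
  sameImage⇒agree {π = π} {σ = σ} π-supported σ-supported πB≐σB {k} k∈L =
    trans (sym (inverseʳ σ)) (cong (σ ⟨$⟩ʳ_) σ⁻¹πk≡k)
    where
    σ⁻¹πk≡k : σ ⟨$⟩ˡ (π ⟨$⟩ʳ k) ≡ k
    σ⁻¹πk≡k = inStab∧supported⇒fixes {g = π ∘ₚ flip σ}
      (sameImage⇒inStab (supporting⇒extensional (proj₁ sp)) {π = π} {σ = σ} πB≐σB)
      (supported-∘ₚ {π = π} {σ = flip σ} π-supported (supported-flip {π = σ} σ-supported)) k∈L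

-- Shuffles

transpose-fixes : ∀ {i j k : Fin n} → k ≢ i → k ≢ j → PC.transpose i j k ≡ k
transpose-fixes {i = i} {j} {k} k≢i k≢j rewrite dec-false (k ≟ i) k≢i | dec-false (k ≟ j) k≢j = refl

transpose-moves : ∀ (i j : Fin n) → PC.transpose i j i ≡ j
transpose-moves i j rewrite dec-true (i ≟ i) refl = refl

remQuot-injective : ∀ {n} k {u v : Fin (n * k)} → remQuot {n} k u ≡ remQuot k v → u ≡ v
remQuot-injective {n} k {u} {v} eq =
  trans (sym (combine-remQuot {n} k u)) (trans (cong (uncurry combine) eq) (combine-remQuot {n} k v))

lookup-injective : ∀ {a} {A : Set a} {xs : List A} → Unique xs → Injective _≡_ _≡_ (lookup xs)
lookup-injective {xs = _ ∷ _}  _           {zero}  {zero}  _  = refl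
lookup-injective {xs = _ ∷ _}  (x∉ ∷ _)    {zero}  {suc j} eq = ⊥-elim (All.lookup x∉ (∈-lookup j) eq)
lookup-injective {xs = _ ∷ _}  (x∉ ∷ _)    {suc i} {zero}  eq = ⊥-elim (All.lookup x∉ (∈-lookup i) (sym eq))
lookup-injective {xs = _ ∷ xs} (_ ∷ uniq)  {suc i} {suc j} eq = cong suc (lookup-injective uniq eq)

-- The index is read in the factorial number system: its leading digit
-- chooses where the head of L goes, the remaining digits shuffle the tail.
mutual
  shuffle : (L : List (Fin n)) → Fin (length L !) → Sym n
  shuffle []      _ = id
  shuffle (y ∷ L) u = shuffle-step y L (remQuot (length L !) u)

  shuffle-step : (y : Fin n) (L : List (Fin n)) → Fin (suc (length L)) × Fin (length L !) → Sym n
  shuffle-step y L (i , v) = shuffle L v ∘ₚ transpose y (lookup (y ∷ L) i)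

mutual
  shuffle-supported : ∀ (L : List (Fin n)) u → Supported L (shuffle L u)
  shuffle-supported []      u k _   = refl
  shuffle-supported (y ∷ L) u = shuffle-step-supported y L (remQuot (length L !) u)

  shuffle-step-supported : ∀ y (L : List (Fin n)) p → Supported (y ∷ L) (shuffle-step y L p)
  shuffle-step-supported y L (i , v) k k∉ =
    trans (cong (PC.transpose y t) (shuffle-supported L v k (k∉ ∘ there)))
          (transpose-fixes (k∉ ∘ here) (λ k≡t → k∉ (subst (_∈ y ∷ L) (sym k≡t) (∈-lookup i))))
    where
    t : Fin _
    t = lookup (y ∷ L) i

shuffle-step-leading-digit : ∀ {y} {L : List (Fin n)} → Unique (y ∷ L) → ∀ {i u j v} →
                             shuffle-step y L (i , u) ⟨$⟩ʳ y ≡ shuffle-step y L (j , v) ⟨$⟩ʳ y → i ≡ j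
shuffle-step-leading-digit {y = y} {L} uniq@(y≢L ∷ _) {i} {u} {j} {v} same = lookup-injective uniq (begin
  lookup (y ∷ L) i                   ≡⟨ head-image i u ⟨
  shuffle-step y L (i , u) ⟨$⟩ʳ y    ≡⟨ same ⟩
  shuffle-step y L (j , v) ⟨$⟩ʳ y    ≡⟨ head-image j v ⟩
  lookup (y ∷ L) j                   ∎)
  where
  open ≡-Reasoning
  head-image : ∀ i u → shuffle-step y L (i , u) ⟨$⟩ʳ y ≡ lookup (y ∷ L) i
  head-image i u = trans (cong (PC.transpose y _) (shuffle-supported L u y (All¬⇒¬Any y≢L)))
                         (transpose-moves y _)

mutual
  shuffle-injective : ∀ {L : List (Fin n)} → Unique L → ∀ u v →
                      (∀ {k} → k ∈ L → shuffle L u ⟨$⟩ʳ k ≡ shuffle L v ⟨$⟩ʳ k) → u ≡ v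
  shuffle-injective {L = []}    _    zero zero _     = refl
  shuffle-injective {L = y ∷ L} uniq u    v    agree =
    remQuot-injective (length L !) (shuffle-step-injective uniq _ _ agree)

  shuffle-step-injective : ∀ {y} {L : List (Fin n)} → Unique (y ∷ L) → ∀ p q →
                           (∀ {k} → k ∈ y ∷ L → shuffle-step y L p ⟨$⟩ʳ k ≡ shuffle-step y L q ⟨$⟩ʳ k) →
                           p ≡ q
  shuffle-step-injective {y = y} {L} uniq@(_ ∷ L-unique) (i , u) (j , v) agree
    with refl ← shuffle-step-leading-digit uniq {i} {u} {j} {v} (agree (here refl))
    = cong (i ,_) (shuffle-injective L-unique u v λ k∈L →
        ⟨$⟩ʳ-injective (transpose y (lookup (y ∷ L) i)) (agree (there k∈L)))

-- Counting parts and orbits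

least-witness : ∀ {p} {P : Pred (Fin n) p} → Decidable P → ∃ P → ∃[ i ] P i × (∀ j → j <ᶠ i → ¬ P j)
least-witness {n = n} {P = P} P? (x , Px) with ¬∀⟶∃¬-smallest n (∁ P) (¬? ∘ P?) (λ ¬P → ¬P x Px)
... | i , ¬¬Pi , below = i , decidable-stable (P? i) ¬¬Pi , λ j j<i → subst (∁ P) (inject-fromℕ< j<i) (below (fromℕ< j<i))
  where
  inject-fromℕ< : ∀ {j} (j<i : j <ᶠ i) → inject (fromℕ< j<i) ≡ j
  inject-fromℕ< j<i = toℕ-injective (trans (toℕ-inject (fromℕ< j<i)) (toℕ-fromℕ< j<i))

∈-injection⇒≤length : ∀ {a} {A : Set a} {xs : List A} (f : Fin m → A) →
                      Injective _≡_ _≡_ f → (∀ i → f i ∈ xs) → m ≤ length xs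
∈-injection⇒≤length {A = A} f f-injective f∈xs = injective⇒≤ λ {i} {j} eq →
  f-injective (SetoidMembership.index-injective (setoid A) (f∈xs i) (f∈xs j) eq)

module Parts (c : Fin n → Fin m) where

  IsRepresentative : Fin n → Set
  IsRepresentative i = (∀ j → j <ᶠ i → c j ≢ c i) × (∃[ j ] j ≢ i × c j ≡ c i)

  isRepresentative? : Decidable IsRepresentative
  isRepresentative? i = all? (λ j → (j <? i) →-dec ¬? (c j ≟ c i))
                  ×-dec any? (λ j → ¬? (j ≟ i) ×-dec (c j ≟ c i))

  representatives : List (Fin n)
  representatives = filter isRepresentative? (allFin n)

  representatives-unique : Unique representatives
  representatives-unique = filter⁺ isRepresentative? (allFin⁺ n)

  representative : ∀ {a} → a ∈ representatives → IsRepresentative a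
  representative = proj₂ ∘ ∈-filter⁻ isRepresentative? {xs = allFin n}

  representatives-distinct : ∀ {a b} → a ∈ representatives → b ∈ representatives → c a ≡ c b → a ≡ b
  representatives-distinct {a} {b} a∈ b∈ ca≡cb with <-cmp a b
  ... | tri< a<b _ _ = ⊥-elim (proj₁ (representative b∈) a a<b ca≡cb)
  ... | tri≈ _ a≡b _ = a≡b
  ... | tri> _ _ b<a = ⊥-elim (proj₁ (representative a∈) b b<a (sym ca≡cb))

  representative-partner : ∀ {a} → a ∈ representatives → ∃[ x ] x ≢ a × c x ≡ c a
  representative-partner = proj₂ ∘ representative

  singletons : List (Fin n)
  singletons = filter (λ k → isSingleton c k Bool.≟ true) (allFin n)

  least∈representatives++singletons : ∀ {i} → (∀ j → j <ᶠ i → c j ≢ c i) → i ∈ representatives ++ singletons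
  least∈representatives++singletons {i} least with any? (λ j → ¬? (j ≟ i) ×-dec (c j ≟ c i))
  ... | yes partner = ∈-++⁺ˡ (∈-filter⁺ isRepresentative? (∈-allFin i) (least , partner))
  ... | no ¬partner = ∈-++⁺ʳ representatives
    (∈-filter⁺ (λ k → isSingleton c k Bool.≟ true) (∈-allFin i) (Equivalence.to T-≡ (fromWitness alone)))
    where
    alone : All.All (λ j → c j ≡ c i → j ≡ i) (allFin n)
    alone = All.tabulate λ {j} _ cj≡ci → decidable-stable (j ≟ i) (λ j≢i → ¬partner (j , j≢i , cj≡ci))

  #parts≤ : Surjective _≡_ _≡_ c → m ≤ length representatives + numSingletons c
  #parts≤ surjective = subst (m ≤_) (length-++ representatives)
    (∈-injection⇒≤length least least-injective (λ q → least∈representatives++singletons (least-below q)))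
    where
    least-in : ∀ q → ∃[ i ] c i ≡ q × (∀ j → j <ᶠ i → ¬ c j ≡ q)
    least-in q = least-witness (λ i → c i ≟ q) (proj₁ (surjective q) , proj₂ (surjective q) refl)

    least : Fin m → Fin n
    least q = proj₁ (least-in q)

    least-part : ∀ q → c (least q) ≡ q
    least-part q = proj₁ (proj₂ (least-in q))

    least-injective : Injective _≡_ _≡_ least
    least-injective {q} {q′} eq = trans (sym (least-part q)) (trans (cong c eq) (least-part q′))

    least-below : ∀ q → ∀ j → j <ᶠ least q → c j ≢ c (least q)
    least-below q j j<i cj≡ = proj₂ (proj₂ (least-in q)) j j<i (trans cj≡ (least-part q))

module _ {c : Fin n → Fin m} (sp : IsSP B c) where

  factorial≤orbitSize : ∀ {L o} → Unique L →
                        (∀ {a b} → a ∈ L → b ∈ L → c a ≡ c b → a ≡ b) →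
                        (∀ {a} → a ∈ L → ∃[ x ] x ≢ a × c x ≡ c a) →
                        IsOrbitSize B o → length L ! ≤ o
  factorial≤orbitSize {L = L} {o} L-unique distinct partner (e , covers , _) =
    injective⇒≤ {f = orbitIndex} orbitIndex-injective
    where
    orbitIndex : Fin (length L !) → Fin o
    orbitIndex u = proj₁ (covers (shuffle L u))

    orbitIndex-injective : Injective _≡_ _≡_ orbitIndex
    orbitIndex-injective {u} {v} eq = shuffle-injective L-unique u v
      (sameImage⇒agree sp distinct partner {π = shuffle L u} {σ = shuffle L v}
        (shuffle-supported L u) (shuffle-supported L v) sameImage)
      where
      sameImage : actS (shuffle L u) B ≐ actS (shuffle L v) B
      sameImage w = trans (proj₂ (covers (shuffle L u)) w)
                   (trans (cong (λ i → actS (e i) B w) eq) (sym (proj₂ (covers (shuffle L v)) w)))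

  nonSingletonParts-bound : ∀ {o} → IsOrbitSize B o → ∃[ r ] m ≤ r + numSingletons c × r ! ≤ o
  nonSingletonParts-bound orbit =
    length representatives ,
    #parts≤ (proj₁ (proj₁ sp)) ,
    factorial≤orbitSize representatives-unique representatives-distinct representative-partner orbit
    where open Parts c

toℚᵘ-/ : ∀ i d .{{_ : NonZero d}} → ℚ.toℚᵘ (i ℚ./ d) ℚᵘ.≃ (i ℚᵘ./ d)
toℚᵘ-/ i (suc d) = ℚ.toℚᵘ-fromℚᵘ (ℚᵘ.mkℚᵘ i d)

ℕ/≤ℕ/⇒*≤* : ∀ x y a b .{{_ : NonZero a}} .{{_ : NonZero b}} →
            (+ x) ℚ./ a ℚ.≤ (+ y) ℚ./ b → x * b ≤ y * a
ℕ/≤ℕ/⇒*≤* x y a@(suc _) b@(suc _) x/a≤y/b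
  with ℚᵘ.≤-respˡ-≃ (toℚᵘ-/ (+ x) a) (ℚᵘ.≤-respʳ-≃ (toℚᵘ-/ (+ y) b) (ℚ.toℚᵘ-mono-≤ x/a≤y/b))
... | ℚᵘ.*≤* xb≤ya = ℤ.drop‿+≤+ (subst₂ ℤ._≤_ (sym (ℤ.pos-* x b)) (sym (ℤ.pos-* y a)) xb≤ya)

*≤*⇒ℕ/≤ℕ/ : ∀ x y a b .{{_ : NonZero a}} .{{_ : NonZero b}} →
            x * b ≤ y * a → (+ x) ℚ./ a ℚ.≤ (+ y) ℚ./ b
*≤*⇒ℕ/≤ℕ/ x y a@(suc _) b@(suc _) xb≤ya =
  ℚ.toℚᵘ-cancel-≤ (ℚᵘ.≤-respˡ-≃ (ℚᵘ.≃-sym (toℚᵘ-/ (+ x) a)) (ℚᵘ.≤-respʳ-≃ (ℚᵘ.≃-sym (toℚᵘ-/ (+ y) b))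
    (ℚᵘ.*≤* (subst₂ ℤ._≤_ (ℤ.pos-* x b) (ℤ.pos-* y a) (ℤ.+≤+ xb≤ya)))))

ℕ/<ℕ/⇒*<* : ∀ x y a b .{{_ : NonZero a}} .{{_ : NonZero b}} →
            (+ x) ℚ./ a ℚ.< (+ y) ℚ./ b → x * b < y * a
ℕ/<ℕ/⇒*<* x y a@(suc _) b@(suc _) x/a<y/b
  with ℚᵘ.<-respˡ-≃ (toℚᵘ-/ (+ x) a) (ℚᵘ.<-respʳ-≃ (toℚᵘ-/ (+ y) b) (ℚ.toℚᵘ-mono-< x/a<y/b))
... | ℚᵘ.*<* xb<ya = ℤ.drop‿+<+ (subst₂ ℤ._<_ (sym (ℤ.pos-* x b)) (sym (ℤ.pos-* y a)) xb<ya)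

ℕ/-*-ℕtoℚ : ∀ x y a .{{_ : NonZero a}} → ((+ x) ℚ./ a) ℚ.* ℕtoℚ y ≡ (+ (x * y)) ℚ./ a
ℕ/-*-ℕtoℚ x y a@(suc _) = ℚ.toℚᵘ-injective (begin
  ℚ.toℚᵘ ((+ x) ℚ./ a ℚ.* ℕtoℚ y)              ≈⟨ ℚ.toℚᵘ-homo-* ((+ x) ℚ./ a) (ℕtoℚ y) ⟩
  ℚ.toℚᵘ ((+ x) ℚ./ a) ℚᵘ.* ℚ.toℚᵘ (ℕtoℚ y)   ≈⟨ ℚᵘ.*-cong (toℚᵘ-/ (+ x) a) (toℚᵘ-/ (+ y) 1) ⟩
  ((+ x) ℚᵘ./ a) ℚᵘ.* ((+ y) ℚᵘ./ 1)          ≡⟨ ℚᵘ./-cong (sym (ℤ.pos-* x y)) (*-identityʳ a) ⟩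
  (+ (x * y)) ℚᵘ./ a                          ≈⟨ toℚᵘ-/ (+ (x * y)) a ⟨
  ℚ.toℚᵘ ((+ (x * y)) ℚ./ a)                  ∎)
  where open ℚᵘ.≃-Reasoning

ℕtoℚ-+ : ∀ x y → ℕtoℚ (x + y) ≡ ℕtoℚ x ℚ.+ ℕtoℚ y
ℕtoℚ-+ x y = ℚ.toℚᵘ-injective (begin
  ℚ.toℚᵘ (ℕtoℚ (x + y))                        ≈⟨ toℚᵘ-/ (+ (x + y)) 1 ⟩
  (+ (x + y)) ℚᵘ./ 1                           ≡⟨ ℚᵘ./-cong numerators refl ⟩
  ((+ x) ℚᵘ./ 1) ℚᵘ.+ ((+ y) ℚᵘ./ 1)           ≈⟨ ℚᵘ.+-cong (toℚᵘ-/ (+ x) 1) (toℚᵘ-/ (+ y) 1) ⟨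
  ℚ.toℚᵘ (ℕtoℚ x) ℚᵘ.+ ℚ.toℚᵘ (ℕtoℚ y)         ≈⟨ ℚ.toℚᵘ-homo-+ (ℕtoℚ x) (ℕtoℚ y) ⟨
  ℚ.toℚᵘ (ℕtoℚ x ℚ.+ ℕtoℚ y)                   ∎)
  where
  open ℚᵘ.≃-Reasoning
  numerators : + (x + y) ≡ + x ℤ.* + 1 ℤ.+ + y ℤ.* + 1
  numerators = trans (ℤ.pos-+ x y) (sym (cong₂ ℤ._+_ (ℤ.*-identityʳ (+ x)) (ℤ.*-identityʳ (+ y))))

p≤∣p∣ : ∀ p → p ℚ.≤ ℚ.∣ p ∣
p≤∣p∣ p with ℚ.≤-total p ℚ.0ℚ
... | inj₁ p≤0 = ℚ.≤-trans p≤0 (ℚ.0≤∣p∣ p)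
... | inj₂ 0≤p = ℚ.≤-reflexive (sym (ℚ.0≤p⇒∣p∣≡p 0≤p))

-- Growth

Eventually : (ℕ → Set) → Set
Eventually P = ∃[ N ] ∀ n → N ≤ n → P n

eventually-× : ∀ {P Q : ℕ → Set} → Eventually P → Eventually Q → Eventually (λ n → P n × Q n)
eventually-× (N₁ , p) (N₂ , q) =
  N₁ ⊔ N₂ , λ n N≤n → p n (m⊔n≤o⇒m≤o N₁ N₂ N≤n) , q n (m⊔n≤o⇒n≤o N₁ N₂ N≤n)

few-singletons : ∀ {f : ℕ → ℚ} {s : ℕ → ℕ} → LittleO f → (∀ n → ℕtoℚ (s n) ≤ℚ f n) →
                 ∀ d → Eventually (λ n → suc d * s n ≤ n)
few-singletons {f} {s} f∈o[n] s≤f d = proj₁ small , λ n N≤n →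
  subst₂ _≤_ (*-comm (s n) (suc d)) (trans (*-identityʳ (1 * n)) (*-identityˡ n))
    (ℕ/≤ℕ/⇒*≤* (s n) (1 * n) 1 (suc d) (begin
      ℕtoℚ (s n)              ≤⟨ s≤f n ⟩
      f n                     ≤⟨ p≤∣p∣ (f n) ⟩
      ℚ.∣ f n ∣               ≤⟨ proj₂ small n N≤n ⟩
      ε ℚ.* ℕtoℚ n            ≡⟨ ℕ/-*-ℕtoℚ 1 n (suc d) ⟩
      (+ (1 * n)) ℚ./ suc d   ∎))
  where
  open ℚ.≤-Reasoning
  ε : ℚ
  ε = (+ 1) ℚ./ suc d

  small : Eventually (λ n → ℚ.∣ f n ∣ ℚ.≤ ε ℚ.* ℕtoℚ n)
  small = f∈o[n] ε (ℚ.positive⁻¹ ε {{ℚ.normalize-pos 1 (suc d)}})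

cauchy⇒eventually-bounded : ∀ {o : ℕ → ℕ} k → Cauchy (λ n → over2^ (o n) k n) →
                            ∃[ M ] Eventually (λ n → o n < M * 2 ^ (k * n))
cauchy⇒eventually-bounded {o} k cauchy with cauchy ℚ.1ℚ (ℚ.positive⁻¹ ℚ.1ℚ)
... | N , close = suc (o N) , N , λ n N≤n → bound n (close n N N≤n ≤-refl)
  where
  open ℚ.≤-Reasoning
  open import Algebra.Properties.Group ℚ.+-0-group using (//-rightDividesˡ)

  q≤oN : over2^ (o N) k N ℚ.≤ ℕtoℚ (o N)
  q≤oN = *≤*⇒ℕ/≤ℕ/ (o N) (o N) (2 ^ (k * N)) 1 {{m^n≢0 2 (k * N)}} (*-monoʳ-≤ (o N) (m^n>0 2 (k * N)))

  bound : ∀ n → ℚ.∣ over2^ (o n) k n ℚ.- over2^ (o N) k N ∣ ℚ.< ℚ.1ℚ → o n < suc (o N) * 2 ^ (k * n)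
  bound n |p-q|<1 = subst (_< suc (o N) * 2 ^ (k * n)) (*-identityʳ (o n))
    (ℕ/<ℕ/⇒*<* (o n) (suc (o N)) (2 ^ (k * n)) 1 {{m^n≢0 2 (k * n)}} (begin-strict
      p                       ≡⟨ //-rightDividesˡ q p ⟨
      (p ℚ.- q) ℚ.+ q         <⟨ ℚ.+-monoˡ-< q (ℚ.≤-<-trans (p≤∣p∣ (p ℚ.- q)) |p-q|<1) ⟩
      ℚ.1ℚ ℚ.+ q              ≤⟨ ℚ.+-monoʳ-≤ ℚ.1ℚ q≤oN ⟩
      ℚ.1ℚ ℚ.+ ℕtoℚ (o N)     ≡⟨ ℕtoℚ-+ 1 (o N) ⟨
      ℕtoℚ (suc (o N))        ∎))
    where
    p q : ℚ
    p = over2^ (o n) k n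
    q = over2^ (o N) k N

m≤n+o⇒o+o≤m⇒m≤n+n : ∀ {m n o} → m ≤ n + o → o + o ≤ m → m ≤ n + n
m≤n+o⇒o+o≤m⇒m≤n+n {m} {n} {o} m≤n+o o+o≤m = +-cancelʳ-≤ m m (n + n) (begin
  m + m              ≤⟨ +-mono-≤ m≤n+o m≤n+o ⟩
  (n + o) + (n + o)  ≡⟨ +-interchange n o n o ⟩
  (n + n) + (o + o)  ≤⟨ +-monoʳ-≤ (n + n) o+o≤m ⟩
  (n + n) + m        ∎)
  where open ≤-Reasoning

nonSingletons-linear : ∀ {n a m r s} → n ≤ a * m → m ≤ r + s → suc (a + a) * s ≤ n → n ≤ suc (a + a) * r
nonSingletons-linear {n} {a} {m} {r} {s} n≤am m≤r+s [1+2a]s≤n = begin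
  n                  ≤⟨ m≤n+o⇒o+o≤m⇒m≤n+n {n = a * r} {a * s} n≤ar+as 2as≤n ⟩
  a * r + a * r      ≡⟨ *-distribʳ-+ r a a ⟨
  (a + a) * r        ≤⟨ m≤n+m _ r ⟩
  suc (a + a) * r    ∎
  where
  open ≤-Reasoning
  n≤ar+as : n ≤ a * r + a * s
  n≤ar+as = ≤-trans n≤am (≤-trans (*-monoʳ-≤ a m≤r+s) (≤-reflexive (*-distribˡ-+ a r s)))
  2as≤n : a * s + a * s ≤ n
  2as≤n = ≤-trans (≤-reflexive (sym (*-distribʳ-+ s a a))) (≤-trans (m≤n+m _ s) [1+2a]s≤n)

n≤2^n : ∀ n → n ≤ 2 ^ n
n≤2^n zero    = z≤n
n≤2^n (suc n) = subst (suc n ≤_) (cong (λ k → 2 ^ n + k) (sym (+-identityʳ (2 ^ n))))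
                      (+-mono-≤ (m^n>0 2 n) (n≤2^n n))

^≤[+]! : ∀ m n → m ^ n ≤ (m + n) !
^≤[+]! m zero    = 1≤n! (m + 0)
^≤[+]! m (suc n) = subst (λ k → m * m ^ n ≤ k !) (sym (+-suc m n))
                         (*-mono-≤ (≤-trans (m≤m+n m n) (n≤1+n _)) (^≤[+]! m n))

^-distribʳ-* : ∀ m n o → (m * n) ^ o ≡ m ^ o * n ^ o
^-distribʳ-* m n zero    = refl
^-distribʳ-* m n (suc o) = trans (cong (m * n *_) (^-distribʳ-* m n o)) (*-interchange m n (m ^ o) (n ^ o))

-- With K = 2C, t = r ∸ K ≥ M·C^K:  M·C^r = M·C^K·C^t ≤ 2^t·C^t = K^t ≤ (K + t)! = r!.
factorial-dominates-exponential : ∀ M C → Eventually (λ r → M * C ^ r ≤ r !)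
factorial-dominates-exponential M C = K + M * C ^ K , λ r K+MC^K≤r →
  subst (λ r → M * C ^ r ≤ r !) (m+[n∸m]≡n (≤-trans (m≤m+n K _) K+MC^K≤r))
        (bound (r ∸ K) (+-cancelˡ-≤ K _ _ (≤-trans K+MC^K≤r (m≤n+m∸n r K))))
  where
  open ≤-Reasoning
  K : ℕ
  K = 2 * C
  bound : ∀ t → M * C ^ K ≤ t → M * C ^ (K + t) ≤ (K + t) !
  bound t MC^K≤t = begin
    M * C ^ (K + t)      ≡⟨ cong (M *_) (^-distribˡ-+-* C K t) ⟩
    M * (C ^ K * C ^ t)  ≡⟨ *-assoc M (C ^ K) (C ^ t) ⟨
    M * C ^ K * C ^ t    ≤⟨ *-monoˡ-≤ (C ^ t) (≤-trans MC^K≤t (n≤2^n t)) ⟩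
    2 ^ t * C ^ t        ≡⟨ ^-distribʳ-* 2 C t ⟨
    K ^ t                ≤⟨ ^≤[+]! K t ⟩
    (K + t) !            ∎

¬exponentially-bounded : ∀ {d} {r o : ℕ → ℕ} → Eventually (λ n → n ≤ suc d * r n) →
                         (∀ n → r n ! ≤ o n) → ∀ k M → ¬ Eventually (λ n → o n < M * 2 ^ (k * n))
¬exponentially-bounded {d} {r} {o} linear r!≤o k M bounded = <-irrefl refl (begin-strict
  M * 2 ^ (k * n₀) ≤⟨ *-monoʳ-≤ M 2^kn≤C^r ⟩
  M * C ^ r n₀     ≤⟨ proj₂ dominated (r n₀) R≤r ⟩
  r n₀ !           ≤⟨ r!≤o n₀ ⟩
  o n₀             <⟨ proj₂ (proj₂ both n₀ N≤n₀) ⟩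
  M * 2 ^ (k * n₀) ∎)
  where
  open ≤-Reasoning
  C : ℕ
  C = 2 ^ (k * suc d)

  dominated : Eventually (λ r → M * C ^ r ≤ r !)
  dominated = factorial-dominates-exponential M C

  both : Eventually (λ n → n ≤ suc d * r n × o n < M * 2 ^ (k * n))
  both = eventually-× linear bounded

  n₀ : ℕ
  n₀ = proj₁ both ⊔ suc d * proj₁ dominated

  N≤n₀ : proj₁ both ≤ n₀
  N≤n₀ = m≤m⊔n _ _

  n₀≤Dr : n₀ ≤ suc d * r n₀
  n₀≤Dr = proj₁ (proj₂ both n₀ N≤n₀)

  R≤r : proj₁ dominated ≤ r n₀
  R≤r = *-cancelˡ-≤ (suc d) (≤-trans (m≤n⊔m _ _) n₀≤Dr)

  2^kn≤C^r : 2 ^ (k * n₀) ≤ C ^ r n₀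
  2^kn≤C^r = begin
    2 ^ (k * n₀)               ≤⟨ ^-monoʳ-≤ 2 (*-monoʳ-≤ k n₀≤Dr) ⟩
    2 ^ (k * (suc d * r n₀))   ≡⟨ cong (2 ^_) (*-assoc k (suc d) (r n₀)) ⟨
    2 ^ (k * suc d * r n₀)     ≡⟨ ^-*-assoc 2 (k * suc d) (r n₀) ⟨
    C ^ r n₀                   ∎

lemma25 : (p : ℕ → ℕ) (P : (n : ℕ) → Fin (p n) → Subset n)
          → (∀ n → IsOrderedPartition (P n))
          → (b : (n : ℕ) → Fin (p n))
          → (m : ℕ → ℕ) (c : (n : ℕ) → Fin n → Fin (m n))
          → (∀ n → IsSP (P n (b n)) (c n))
          → (∀ n (i : Fin (p n)) (m′ : ℕ) (c′ : Fin n → Fin m′) → IsSP (P n i) c′ → m′ ≤ m n)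
          → (f : ℕ → ℚ) → LittleO f
          → (∀ n → ℕtoℚ (numSingletons (c n)) ≤ℚ f n)
          → ThetaN m
          → (o : ℕ → ℕ) → (∀ n → IsOrbitSize (P n (b n)) (o n))
          → ∀ (k : ℕ) → ¬ Cauchy (λ n → over2^ (o n) k n)
lemma25 _ _ _ _ m c isSP _ f f∈o[n] s≤f (a , _ , N , θ) o orbit k cauchy =
  uncurry (¬exponentially-bounded {a + a} {r} {o} linear r!≤o k) (cauchy⇒eventually-bounded {o} k cauchy)
  where
  parts : ∀ n → ∃[ r ] m n ≤ r + numSingletons (c n) × r ! ≤ o n
  parts n = nonSingletonParts-bound (isSP n) (orbit n)

  r : ℕ → ℕ
  r n = proj₁ (parts n)

  r!≤o : ∀ n → r n ! ≤ o n
  r!≤o n = proj₂ (proj₂ (parts n))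

  s : ℕ → ℕ
  s n = numSingletons (c n)

  lower : Eventually (λ n → n ≤ a * m n)
  lower = N , λ n N≤n → proj₁ (θ n N≤n)

  linear : Eventually (λ n → n ≤ suc (a + a) * r n)
  linear with eventually-× lower (few-singletons {s = s} f∈o[n] s≤f (a + a))
  ... | N′ , bounds = N′ , λ n N′≤n →
    nonSingletons-linear {a = a} {m n} {r n} {s n}
      (proj₁ (bounds n N′≤n)) (proj₁ (proj₂ (parts n))) (proj₂ (bounds n N′≤n))
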